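{- Let $\mathcal{X}=(\Omega,S)$ be the Tatra scheme $\mathcal{X}(q,n)$ and let $r_C=\bigcup_{g\in C}r_g$. Then $|\alpha s_g\cap\Gamma|=1$ for all $\alpha\in\Omega$, $g\in C$, and every equivalence class $\Gamma\in\Omega/r_C$ such that $\alpha\notin\Gamma$.
   Context: Let $r$ be a prime, $q=r^d$, $\mathbb{F}=\mathbb{F}_q$, $n\mid q-1$ with $q(q-1)/n$ even, $K\le\mathbb{F}^*$ the subgroup of index $n$, $C=\mathbb{F}^*/K$. $\Omega=\{Kv:v\in\mathbb{F}^2\setminus\{0\}\}$ with $Kv=\{xv:x\in K\}$; for $g=Ky\in C$, $g(Kv)=K(yv)$. $\langle Ku,Kv\rangle=K\det(u,v)\in C\cup\{0\}$ (value $0$ iff $\det(u,v)=0$), $\det(u,v)=u_1v_2-u_2v_1$. For $g\in C$: $r_g=\{(\alpha,\beta)\in\Omega^2:\langle\alpha,\beta\rangle=0,\ \beta=g\alpha\}$, $s_g=\{(\alpha,\beta)\in\Omega^2:\langle\alpha,\beta\rangle=g\}$; $S=\{r_g,s_g:g\in C\}$, and $(\Omega,S)$ is an association scheme. $r_C$ is the equivalence relation $\{(\alpha,g\alpha):\alpha\in\Omega,g\in C\}$, and $\Omega/r_C$ denotes its set of classes. For a relation $s$ and $\alpha\in\Omega$, $\alpha s=\{\beta\in\Omega:(\alpha,\beta)\in s\}$. -}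

module Defs where

open import Level using (0ℓ)
open import Data.Nat as ℕ using (ℕ; _∸_)
open import Data.Product using (Σ; ∃; _×_; _,_)
open import Data.List using (List; length; filter)
open import Data.List.Membership.Propositional using (_∈_)
open import Data.List.Relation.Unary.Unique.Propositional using (Unique)
open import Relation.Binary.PropositionalEquality using (_≡_; _≢_)
open import Relation.Binary.Definitions using (DecidableEquality)
open import Relation.Unary using (Pred; Decidable)
open import Relation.Nullary using (¬_)
open import Algebra.Structures using (IsCommutativeRing)

record FiniteField : Set₁ where
  infixl 7 _*_
  infixl 6 _+_
  field
    Carrier  : Set
    _+_ _*_  : Carrier → Carrier → Carrier
    -_       : Carrier → Carrier
    0# 1#    : Carrier
    isCommutativeRing : IsCommutativeRing _≡_ _+_ _*_ -_ 0# 1#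
    0≢1      : 0# ≢ 1#
    inverse  : ∀ x → x ≢ 0# → ∃ λ y → x * y ≡ 1#
    _≟_      : DecidableEquality Carrier
    elements : List Carrier
    complete : ∀ x → x ∈ elements
    unique   : Unique elements

  size : ℕ
  size = length elements

module _ (F : FiniteField) where
  open FiniteField F

  record IsSubgroupOfIndex (n : ℕ) (K : Pred Carrier 0ℓ) : Set where
    field
      K?       : Decidable K
      K-nonzero : ∀ {x} → K x → x ≢ 0#
      K-one    : K 1#
      K-mul    : ∀ {x y} → K x → K y → K (x * y)
      K-inv    : ∀ {x y} → K x → x * y ≡ 1# → K y
      index    : size ∸ 1 ≡ n ℕ.* length (filter K? elements)

module Tatra (F : FiniteField) (K : Pred (FiniteField.Carrier F) 0ℓ) where
  open FiniteField F

  V : Set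
  V = Carrier × Carrier

  -- nonzero vectors of F²; points of Ω are represented by them
  NonZeroV : V → Set
  NonZeroV v = ¬ (v ≡ (0# , 0#))

  scale : Carrier → V → V
  scale x (v₁ , v₂) = (x * v₁ , x * v₂)

  det : V → V → Carrier
  det (u₁ , u₂) (v₁ , v₂) = u₁ * v₂ + - (u₂ * v₁)

  -- Ku = Kv  (equality of points of Ω)
  SameΩ : V → V → Set
  SameΩ u v = ∃ λ x → K x × v ≡ scale x u

  -- (Ku, Kv) ∈ s_g  where g = Ky ∈ C  :  K det(u,v) = K y
  InS : Carrier → V → V → Set
  InS y u v = ∃ λ x → K x × det u v ≡ x * y

  -- (Ku, Kv) ∈ r_C : Kv = g(Ku) = K(yu) for some g = Ky ∈ C
  InRC : V → V → Set
  InRC u v = ∃ λ y → y ≢ 0# × SameΩ (scale y u) v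

{-# OPTIONS --safe #-}

-- The r_C-class Γ of Kγ consists of the points K(tγ), t ≠ 0, i.e. of the
-- punctured line through γ. Kα = Ku lies off that line exactly when
-- D = det(u, γ) ≠ 0, and then det(u, tγ) = t D shows that ⟨Ku, K(tγ)⟩ = Ky
-- holds iff t ∈ K y D⁻¹: the unique point of αs_g ∩ Γ is K(y D⁻¹ γ).
module Submission where

open import Defs
open import Level using (0ℓ)
open import Data.Nat.Divisibility using (_∣_)
open import Data.Nat.Primality using (Prime)
open import Data.Product using (Σ; ∃; _×_; _,_; proj₁; proj₂)
open import Relation.Binary.PropositionalEquality
  using (_≡_; _≢_; refl; sym; trans; cong; cong₂; module ≡-Reasoning)
open import Relation.Unary using (Pred)
open import Data.Empty using (⊥-elim)
open import Relation.Nullary using (¬_; yes; no)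
open import Algebra.Bundles using (CommutativeRing)
import Algebra.Properties.Ring as RingProperties
import Algebra.Properties.CommutativeSemigroup as CommutativeSemigroupProperties

module FieldProperties (F : FiniteField) where
  open FiniteField F
  open ≡-Reasoning

  commutativeRing : CommutativeRing 0ℓ 0ℓ
  commutativeRing = record { isCommutativeRing = isCommutativeRing }

  open CommutativeRing commutativeRing public
    using (*-assoc; *-comm; *-identityˡ; *-identityʳ; zeroˡ; zeroʳ)
  open RingProperties (CommutativeRing.ring commutativeRing) public
    using (x[y-z]≈xy-xz; x∙y⁻¹≈ε⇒x≈y)
  open CommutativeSemigroupProperties (CommutativeRing.*-commutativeSemigroup commutativeRing) public
    using (x∙yz≈y∙xz; xy∙z≈y∙xz)

  divideʳ : ∀ {d d′ t s} → d * d′ ≡ 1# → t * d ≡ s → t ≡ s * d′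
  divideʳ {d} {d′} {t} {s} dd′≡1 td≡s = begin
    t              ≡⟨ sym (*-identityʳ t) ⟩
    t * 1#         ≡⟨ cong (t *_) (sym dd′≡1) ⟩
    t * (d * d′)   ≡⟨ sym (*-assoc t d d′) ⟩
    (t * d) * d′   ≡⟨ cong (_* d′) td≡s ⟩
    s * d′         ∎

  inverse-nonzero : ∀ {x x′} → x * x′ ≡ 1# → x′ ≢ 0#
  inverse-nonzero {x} xx′≡1 refl = 0≢1 (trans (sym (zeroʳ x)) xx′≡1)

  *-cancelˡ-zero : ∀ {a b} → a ≢ 0# → a * b ≡ 0# → b ≡ 0#
  *-cancelˡ-zero {a} {b} a≢0 ab≡0 with inverse a a≢0
  ... | a′ , aa′≡1 = trans (divideʳ aa′≡1 (trans (*-comm b a) ab≡0)) (zeroˡ a′)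

  *-nonzero : ∀ {a b} → a ≢ 0# → b ≢ 0# → a * b ≢ 0#
  *-nonzero a≢0 b≢0 ab≡0 = b≢0 (*-cancelˡ-zero a≢0 ab≡0)

  proportional : ∀ {a b c d} → c ≢ 0# → a * d ≡ b * c →
                 ∃ λ z → a ≡ z * c × b ≡ z * d
  proportional {a} {b} {c} {d} c≢0 ad≡bc with inverse c c≢0
  ... | c′ , cc′≡1 = a * c′ , sym ac′c≡a , sym ac′d≡b
    where
    c′c≡1 : c′ * c ≡ 1#
    c′c≡1 = trans (*-comm c′ c) cc′≡1

    ac′c≡a : (a * c′) * c ≡ a
    ac′c≡a = trans (*-assoc a c′ c) (trans (cong (a *_) c′c≡1) (*-identityʳ a))

    ac′d≡b : (a * c′) * d ≡ b
    ac′d≡b = begin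
      (a * c′) * d   ≡⟨ xy∙z≈y∙xz a c′ d ⟩
      c′ * (a * d)   ≡⟨ cong (c′ *_) ad≡bc ⟩
      c′ * (b * c)   ≡⟨ x∙yz≈y∙xz c′ b c ⟩
      b * (c′ * c)   ≡⟨ cong (b *_) c′c≡1 ⟩
      b * 1#         ≡⟨ *-identityʳ b ⟩
      b              ∎

module TatraProperties (F : FiniteField) (K : Pred (FiniteField.Carrier F) 0ℓ) where
  open FiniteField F
  open Tatra F K
  open FieldProperties F
  open ≡-Reasoning

  scale-assoc : ∀ x z (v : V) → scale x (scale z v) ≡ scale (x * z) v
  scale-assoc x z (v₁ , v₂) = cong₂ _,_ (sym (*-assoc x z v₁)) (sym (*-assoc x z v₂))

  scale-identity : ∀ (v : V) → scale 1# v ≡ v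
  scale-identity (v₁ , v₂) = cong₂ _,_ (*-identityˡ v₁) (*-identityˡ v₂)

  scale-zero : ∀ (v : V) → scale 0# v ≡ (0# , 0#)
  scale-zero (v₁ , v₂) = cong₂ _,_ (zeroˡ v₁) (zeroˡ v₂)

  scale-nonzero : ∀ {x} {v : V} → x ≢ 0# → NonZeroV v → NonZeroV (scale x v)
  scale-nonzero {v = v₁ , v₂} x≢0 v≢0 xv≡0 =
    v≢0 (cong₂ _,_ (*-cancelˡ-zero x≢0 (cong proj₁ xv≡0))
                   (*-cancelˡ-zero x≢0 (cong proj₂ xv≡0)))

  det-scaleʳ : ∀ (u : V) c (v : V) → det u (scale c v) ≡ c * det u v
  det-scaleʳ (u₁ , u₂) c (v₁ , v₂) = begin
    u₁ * (c * v₂) + - (u₂ * (c * v₁))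
      ≡⟨ cong₂ (λ s t → s + - t) (x∙yz≈y∙xz u₁ c v₂) (x∙yz≈y∙xz u₂ c v₁) ⟩
    c * (u₁ * v₂) + - (c * (u₂ * v₁))
      ≡⟨ sym (x[y-z]≈xy-xz c (u₁ * v₂) (u₂ * v₁)) ⟩
    c * (u₁ * v₂ + - (u₂ * v₁))      ∎

  det≡0⇒multiple : ∀ {u γ : V} → NonZeroV γ → det u γ ≡ 0# → ∃ λ t → u ≡ scale t γ
  det≡0⇒multiple {u₁ , u₂} {γ₁ , γ₂} γ≢0 det≡0 with γ₁ ≟ 0# | γ₂ ≟ 0#
  ... | yes γ₁≡0 | yes γ₂≡0 = ⊥-elim (γ≢0 (cong₂ _,_ γ₁≡0 γ₂≡0))
  ... | no γ₁≢0 | _ =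
    let z , u₁≡ , u₂≡ = proportional γ₁≢0 (x∙y⁻¹≈ε⇒x≈y _ _ det≡0)
    in  z , cong₂ _,_ u₁≡ u₂≡
  ... | _ | no γ₂≢0 =
    let z , u₂≡ , u₁≡ = proportional γ₂≢0 (sym (x∙y⁻¹≈ε⇒x≈y _ _ det≡0))
    in  z , cong₂ _,_ u₁≡ u₂≡

  multiple⇒InRC : ∀ {t} {w γ : V} → K 1# → NonZeroV w → w ≡ scale t γ → InRC γ w
  multiple⇒InRC {t} {w} {γ} K1 w≢0 w≡tγ = t , t≢0 , 1# , K1 , trans w≡tγ (sym (scale-identity _))
    where
    t≢0 : t ≢ 0#
    t≢0 refl = w≢0 (trans w≡tγ (scale-zero γ))

  InRC⇒multiple : ∀ {w γ : V} → InRC γ w → ∃ λ t → w ≡ scale t γ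
  InRC⇒multiple {γ = γ} (z , _ , x , _ , w≡xzγ) = x * z , trans w≡xzγ (scale-assoc x z γ)

  ¬InRC⇒det≢0 : ∀ {u γ : V} → K 1# → NonZeroV u → NonZeroV γ → ¬ InRC γ u → det u γ ≢ 0#
  ¬InRC⇒det≢0 K1 u≢0 γ≢0 u∉Γ det≡0 =
    let _ , u≡tγ = det≡0⇒multiple γ≢0 det≡0 in u∉Γ (multiple⇒InRC K1 u≢0 u≡tγ)

  unique-s-neighbour-on-line : ∀ {u γ : V} {y} → K 1# → NonZeroV γ → y ≢ 0# → det u γ ≢ 0# →
    Σ V (λ v → (NonZeroV v × InS y u v × InRC γ v) ×
      (∀ (w : V) → NonZeroV w → InS y u w → InRC γ w → SameΩ v w))
  unique-s-neighbour-on-line {u} {γ} {y} K1 γ≢0 y≢0 D≢0 with inverse (det u γ) D≢0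
  ... | D⁻¹ , DD⁻¹≡1 = scale c γ , (v≢0 , (1# , K1 , det-v) , multiple⇒InRC K1 v≢0 refl) , uniqueness
    where
    c : Carrier
    c = y * D⁻¹

    v≢0 : NonZeroV (scale c γ)
    v≢0 = scale-nonzero (*-nonzero y≢0 (inverse-nonzero DD⁻¹≡1)) γ≢0

    det-v : det u (scale c γ) ≡ 1# * y
    det-v = begin
      det u (scale c γ)        ≡⟨ det-scaleʳ u c γ ⟩
      (y * D⁻¹) * det u γ      ≡⟨ *-assoc y D⁻¹ (det u γ) ⟩
      y * (D⁻¹ * det u γ)      ≡⟨ cong (y *_) (trans (*-comm D⁻¹ (det u γ)) DD⁻¹≡1) ⟩
      y * 1#                   ≡⟨ *-identityʳ y ⟩
      y                        ≡⟨ sym (*-identityˡ y) ⟩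
      1# * y                   ∎

    uniqueness : ∀ (w : V) → NonZeroV w → InS y u w → InRC γ w → SameΩ (scale c γ) w
    uniqueness w _ (k , k∈K , det-w) w∈Γ with InRC⇒multiple w∈Γ
    ... | t , refl = k , k∈K , (begin
      scale t γ             ≡⟨ cong (λ s → scale s γ) t≡kc ⟩
      scale (k * c) γ       ≡⟨ sym (scale-assoc k c γ) ⟩
      scale k (scale c γ)   ∎)
      where
      t≡kc : t ≡ k * c
      t≡kc = begin
        t               ≡⟨ divideʳ DD⁻¹≡1 (trans (sym (det-scaleʳ u t γ)) det-w) ⟩
        (k * y) * D⁻¹   ≡⟨ *-assoc k y D⁻¹ ⟩
        k * c           ∎

open import Data.Nat using (ℕ; _∸_; _*_; _^_)

lemma3p2 : (F : FiniteField) (r d n : ℕ) → Prime r → FiniteField.size F ≡ r ^ d →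
  (n∣ : n ∣ FiniteField.size F ∸ 1) → 2 ∣ FiniteField.size F * _∣_.quotient n∣ →
  (K : Pred (FiniteField.Carrier F) 0ℓ) → IsSubgroupOfIndex F n K →
  let open FiniteField F
      open Tatra F K
  in ∀ (u : V) → NonZeroV u → ∀ (y : Carrier) → y ≢ 0# →
     ∀ (γ : V) → NonZeroV γ → ¬ InRC γ u →
     Σ V (λ v → (NonZeroV v × InS y u v × InRC γ v) ×
       (∀ (w : V) → NonZeroV w → InS y u w → InRC γ w → SameΩ v w))
lemma3p2 F _ _ _ _ _ _ _ K K-subgroup u u≢0 y y≢0 γ γ≢0 u∉Γ =
  unique-s-neighbour-on-line K-one γ≢0 y≢0 (¬InRC⇒det≢0 K-one u≢0 γ≢0 u∉Γ)
  where
  open TatraProperties F K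
  open IsSubgroupOfIndex K-subgroup using (K-one)
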